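{- Let $G$ be a triangle-free graph with $n$ vertices. Then every word that word-represents $G$ has length at least $2n-2$; that is, if $G$ is word-representable, then $\ell(G)\ge 2n-2$.
   Context: All graphs are finite, simple and undirected. A word $w$ over the alphabet $V$ word-represents a graph $G=(V,E)$ if $w$ contains every letter of $V$ at least once and for all distinct $x,y\in V$, $xy\in E$ if and only if $x$ and $y$ alternate in $w$ (the subword of $w$ consisting only of occurrences of $x$ and $y$ has no two equal consecutive letters). $G$ is word-representable if such a word exists, and then $\ell(G)$ is the minimum length of such a word. -}

module Defs where

open import Data.Nat using (ℕ)
open import Data.Fin using (Fin)
open import Data.List using (List; []; _∷_; filter)
open import Data.List.Membership.Propositional using (_∈_)
open import Data.Product using (_×_)
open import Relation.Nullary using (¬_; Dec; yes; no)
open import Relation.Binary.PropositionalEquality using (_≡_)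
open import Data.Sum using (_⊎_)
open import Data.Fin using (_≟_)
open import Data.Empty using (⊥)
open import Data.Unit using (⊤)

record Graph (n : ℕ) : Set₁ where
  field
    Adj     : Fin n → Fin n → Set
    sym     : ∀ {x y} → Adj x y → Adj y x
    irrefl  : ∀ {x} → ¬ Adj x x

open Graph public

TriangleFree : ∀ {n} → Graph n → Set
TriangleFree {n} G =
  (x y z : Fin n) → Adj G x y → Adj G y z → Adj G x z → ⊥

NoRepeatAdjacent : ∀ {n} → List (Fin n) → Set
NoRepeatAdjacent [] = ⊤
NoRepeatAdjacent (a ∷ []) = ⊤
NoRepeatAdjacent (a ∷ b ∷ w) = ¬ (a ≡ b) × NoRepeatAdjacent (b ∷ w)

restrict : ∀ {n} → Fin n → Fin n → List (Fin n) → List (Fin n)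
restrict x y = filter (λ z → dec z)
  where
  dec : ∀ z → Dec (z ≡ x ⊎ z ≡ y)
  dec z with z ≟ x | z ≟ y
  ... | yes p | _ = yes (Data.Sum.inj₁ p)
  ... | no _ | yes q = yes (Data.Sum.inj₂ q)
  ... | no p | no q = no λ { (Data.Sum.inj₁ r) → p r ; (Data.Sum.inj₂ r) → q r }

Alternate : ∀ {n} → List (Fin n) → Fin n → Fin n → Set
Alternate w x y = NoRepeatAdjacent (restrict x y w)

WordRepresents : ∀ {n} → List (Fin n) → Graph n → Set
WordRepresents {n} w G =
  ((x : Fin n) → x ∈ w) ×
  ((x y : Fin n) → ¬ (x ≡ y) → (Adj G x y → Alternate w x y) × (Alternate w x y → Adj G x y))

-- The letters occurring exactly once in a representing word pairwise
-- alternate, so they span a clique of G; in a triangle-free graph at most two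
-- letters are therefore singletons, every other letter occurs at least twice,
-- and the length of the word, being the sum of the letter counts, is at least
-- 2 (n - 2) + 2 = 2n - 2.
module Submission where

open import Defs hiding (sym)
open import Algebra.Properties.CommutativeSemigroup using (interchange)
open import Data.Empty using (⊥-elim)
open import Data.Fin using (Fin; _≟_)
open import Data.List using (List; []; _∷_; length; map; filter; allFin)
open import Data.List.Membership.Propositional using (_∈_)
open import Data.List.Membership.Propositional.Properties using (∈-filter⁻; ∈-allFin)
open import Data.List.Properties
  using (map-cong-local; length-tabulate; filter-accept; filter-reject)
open import Data.List.Relation.Unary.All as All using (All; []; _∷_)
open import Data.List.Relation.Unary.AllPairs using (_∷_)
open import Data.List.Relation.Unary.Any using (here; there)
open import Data.List.Relation.Unary.Unique.Propositional using (Unique)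
open import Data.List.Relation.Unary.Unique.Propositional.Properties using (allFin⁺; filter⁺)
open import Data.Nat using (ℕ; suc; _+_; _*_; _∸_; _≤_; z≤n; s≤s)
  renaming (_≟_ to _≟ℕ_)
open import Data.Nat.ListAction using (sum)
open import Data.Nat.Properties
  using (≤-refl; ≤-trans; ≤-reflexive; n≤1+n; 1+n≰n; ≤∧≢⇒<; +-mono-≤; +-monoˡ-≤;
         +-suc; *-suc; m≤n+o⇒m∸n≤o; +-commutativeSemigroup; module ≤-Reasoning)
open import Data.Product using (_,_; proj₂)
open import Data.Sum using (inj₁; inj₂)
open import Data.Unit using (tt)
open import Function.Base using (id)
open import Relation.Nullary using (yes; no)
open import Relation.Unary using (Pred; Decidable)
open import Relation.Binary.PropositionalEquality
  using (_≡_; _≢_; refl; sym; trans; cong; cong₂; ≢-sym)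

count : ∀ {n} → Fin n → List (Fin n) → ℕ
count x []      = 0
count x (a ∷ w) with x ≟ a
... | yes _ = suc (count x w)
... | no  _ = count x w

module _ {n} {x a : Fin n} (w : List (Fin n)) where

  count-∷-≡ : x ≡ a → count x (a ∷ w) ≡ suc (count x w)
  count-∷-≡ x≡a with x ≟ a
  ... | yes _   = refl
  ... | no  x≢a = ⊥-elim (x≢a x≡a)

  count-∷-≢ : x ≢ a → count x (a ∷ w) ≡ count x w
  count-∷-≢ x≢a with x ≟ a
  ... | yes x≡a = ⊥-elim (x≢a x≡a)
  ... | no  _   = refl

count-∷-≤ : ∀ {n} (x a : Fin n) w → count x w ≤ count x (a ∷ w)
count-∷-≤ x a w with x ≟ a
... | yes _ = n≤1+n _
... | no  _ = ≤-refl

∈⇒1≤count : ∀ {n} {x : Fin n} {w} → x ∈ w → 1 ≤ count x w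
∈⇒1≤count {w = a ∷ w} (here x≡a) = ≤-trans (s≤s z≤n) (≤-reflexive (sym (count-∷-≡ w x≡a)))
∈⇒1≤count {w = a ∷ w} (there x∈w) = ≤-trans (∈⇒1≤count x∈w) (count-∷-≤ _ a w)

count-filter : ∀ {n p} {P : Pred (Fin n) p} (P? : Decidable P) {x} → P x →
               ∀ w → count x (filter P? w) ≡ count x w
count-filter P?     px []      = refl
count-filter P? {x} px (a ∷ w) with P? a
... | yes _ with x ≟ a
...   | yes _ = cong suc (count-filter P? px w)
...   | no  _ = count-filter P? px w
count-filter P? {x} px (a ∷ w) | no ¬pa with x ≟ a
...   | yes refl = ⊥-elim (¬pa px)
...   | no  _    = count-filter P? px w

count≤1⇒noRepeatAdjacent : ∀ {n} (l : List (Fin n)) →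
                           (∀ {z} → z ∈ l → count z l ≤ 1) → NoRepeatAdjacent l
count≤1⇒noRepeatAdjacent []          _    = tt
count≤1⇒noRepeatAdjacent (a ∷ [])    _    = tt
count≤1⇒noRepeatAdjacent (a ∷ b ∷ r) once =
  a≢b , count≤1⇒noRepeatAdjacent (b ∷ r)
          (λ {z} z∈ → ≤-trans (count-∷-≤ z a (b ∷ r)) (once (there z∈)))
  where
  a≢b : a ≢ b
  a≢b refl = 1+n≰n (≤-trans twice (once (here refl)))
    where
    twice : 2 ≤ count a (a ∷ a ∷ r)
    twice = ≤-trans (s≤s (∈⇒1≤count {w = a ∷ r} (here refl)))
                    (≤-reflexive (sym (count-∷-≡ {x = a} (a ∷ r) refl)))

count≤1⇒alternate : ∀ {n} {x y : Fin n} w → count x w ≤ 1 → count y w ≤ 1 → Alternate w x y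
count≤1⇒alternate {x = x} {y} w x≤1 y≤1 = count≤1⇒noRepeatAdjacent (restrict x y w) bound
  where
  bound : ∀ {z} → z ∈ restrict x y w → count z (restrict x y w) ≤ 1
  bound z∈ with proj₂ (∈-filter⁻ _ {xs = w} z∈)
  ... | inj₁ refl = ≤-trans (≤-reflexive (count-filter _ (inj₁ refl) w)) x≤1
  ... | inj₂ refl = ≤-trans (≤-reflexive (count-filter _ (inj₂ refl) w)) y≤1

sum-count-∷ : ∀ {n} {a : Fin n} {xs} w → Unique xs → a ∈ xs →
              sum (map (λ x → count x (a ∷ w)) xs) ≡ suc (sum (map (λ x → count x w) xs))
sum-count-∷ w (a∉xs ∷ _) (here refl) =
  cong₂ _+_ (count-∷-≡ w refl)
        (cong sum (map-cong-local (All.map (λ a≢x → count-∷-≢ w (≢-sym a≢x)) a∉xs)))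
sum-count-∷ w (x∉xs ∷ xs-unique) (there a∈xs) =
  trans (cong₂ _+_ (count-∷-≢ w (All.lookup x∉xs a∈xs)) (sum-count-∷ w xs-unique a∈xs))
        (+-suc _ _)

length≡sum-count : ∀ {n} {xs : List (Fin n)} → Unique xs → (∀ a → a ∈ xs) →
                   ∀ w → length w ≡ sum (map (λ x → count x w) xs)
length≡sum-count {xs = xs} _         _   []      = sym (sum-zeros xs)
  where
  sum-zeros : ∀ {A : Set} (ys : List A) → sum (map (λ _ → 0) ys) ≡ 0
  sum-zeros []       = refl
  sum-zeros (_ ∷ ys) = sum-zeros ys
length≡sum-count           xs-unique ∈xs (a ∷ w) =
  trans (cong suc (length≡sum-count xs-unique ∈xs w)) (sym (sum-count-∷ w xs-unique (∈xs a)))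

2*-suc-≤ : ∀ {a b m L S} → 2 ≤ a + b → 2 * m ≤ L + S → 2 * suc m ≤ (a + L) + (b + S)
2*-suc-≤ {a} {b} {m} {L} {S} 2≤a+b 2m≤L+S = begin
  2 * suc m          ≡⟨ *-suc 2 m ⟩
  2 + 2 * m          ≤⟨ +-mono-≤ 2≤a+b 2m≤L+S ⟩
  (a + b) + (L + S)  ≡⟨ interchange +-commutativeSemigroup a b L S ⟩
  (a + L) + (b + S)  ∎
  where open ≤-Reasoning

module _ {A : Set} (f : A → ℕ) where

  ones : List A → List A
  ones = filter (λ x → f x ≟ℕ 1)

  double-length≤ones+sum : ∀ xs → All (λ x → 1 ≤ f x) xs →
                           2 * length xs ≤ length (ones xs) + sum (map f xs)
  double-length≤ones+sum []       []              = z≤n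
  double-length≤ones+sum (x ∷ xs) (1≤fx ∷ 1≤fxs) with f x ≟ℕ 1
  ... | yes fx≡1 rewrite filter-accept (λ y → f y ≟ℕ 1) {xs = xs} fx≡1 =
    2*-suc-≤ {1} {L = length (ones xs)} {S = sum (map f xs)}
      (s≤s 1≤fx) (double-length≤ones+sum xs 1≤fxs)
  ... | no  fx≢1 rewrite filter-reject (λ y → f y ≟ℕ 1) {xs = xs} fx≢1 =
    2*-suc-≤ {0} {L = length (ones xs)} {S = sum (map f xs)}
      (≤∧≢⇒< 1≤fx (≢-sym fx≢1)) (double-length≤ones+sum xs 1≤fxs)

IsClique : ∀ {n} → Graph n → List (Fin n) → Set
IsClique G xs = ∀ {x y} → x ∈ xs → y ∈ xs → x ≢ y → Adj G x y

triangleFree⇒clique-length≤2 : ∀ {n} {G : Graph n} {xs} → TriangleFree G → Unique xs →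
                                IsClique G xs → length xs ≤ 2
triangleFree⇒clique-length≤2 {xs = []}         _  _ _ = z≤n
triangleFree⇒clique-length≤2 {xs = _ ∷ []}     _  _ _ = s≤s z≤n
triangleFree⇒clique-length≤2 {xs = _ ∷ _ ∷ []} _  _ _ = s≤s (s≤s z≤n)
triangleFree⇒clique-length≤2 {xs = a ∷ b ∷ c ∷ _} triangle-free
  ((a≢b ∷ a≢c ∷ _) ∷ (b≢c ∷ _) ∷ _) clique =
  ⊥-elim (triangle-free a b c (clique a∈ b∈ a≢b) (clique b∈ c∈ b≢c) (clique a∈ c∈ a≢c))
  where
  a∈ = here refl
  b∈ = there (here refl)
  c∈ = there (there (here refl))

singletons : ∀ {n} → List (Fin n) → List (Fin n)
singletons {n} w = ones (λ x → count x w) (allFin n)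

singletons-isClique : ∀ {n} {G : Graph n} {w} → WordRepresents w G → IsClique G (singletons w)
singletons-isClique {n} {w = w} (_ , represents) {x} {y} x∈ y∈ x≢y =
  proj₂ (represents x y x≢y) (count≤1⇒alternate w (once x∈) (once y∈))
  where
  once : ∀ {z} → z ∈ singletons w → count z w ≤ 1
  once z∈ = ≤-reflexive (proj₂ (∈-filter⁻ (λ x → count x w ≟ℕ 1) {xs = allFin n} z∈))

lemma1 : (n : ℕ) (G : Graph n) → TriangleFree G →
         (w : List (Fin n)) → WordRepresents w G → 2 * n ∸ 2 ≤ length w
lemma1 n G triangle-free w represents@(all∈w , _) = m≤n+o⇒m∸n≤o (2 * n) 2 (begin
  2 * n                                 ≡⟨ cong (2 *_) (sym (length-tabulate {n = n} id)) ⟩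
  2 * length (allFin n)                 ≤⟨ double-length≤ones+sum count-in-w (allFin n) occurring ⟩
  length (singletons w) + sum counts    ≤⟨ +-monoˡ-≤ (sum counts) few-singletons ⟩
  2 + sum counts                        ≡⟨ cong (2 +_) (sym (length≡sum-count (allFin⁺ n) ∈-allFin w)) ⟩
  2 + length w                          ∎)
  where
  open ≤-Reasoning
  count-in-w : Fin n → ℕ
  count-in-w x = count x w

  counts : List ℕ
  counts = map count-in-w (allFin n)

  occurring : All (λ x → 1 ≤ count-in-w x) (allFin n)
  occurring = All.tabulate (λ {x} _ → ∈⇒1≤count (all∈w x))

  few-singletons : length (singletons w) ≤ 2
  few-singletons = triangleFree⇒clique-length≤2 {G = G} triangle-free
    (filter⁺ (λ x → count x w ≟ℕ 1) (allFin⁺ n)) (singletons-isClique {G = G} represents)
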